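{- For every interval graph $G$ there exists an interval graph $\tilde{G}$ such that $\tilde{G}$ contains $G$ as an induced subgraph and $\tilde{G}$ is the phylogeny graph $P(D)$ of some doubly partial order $D$.
   Context: All graphs and digraphs are finite and simple. For $x\in\mathbb{R}^2$ write $x=(x_1,x_2)$, and for $x,y\in\mathbb{R}^2$ write $x\prec y$ if $x_1<y_1$ and $x_2<y_2$. A digraph $D$ is a doubly partial order if there is a finite set $V\subseteq\mathbb{R}^2$ with $V(D)=V$ and $A(D)=\{(x,v)\mid v,x\in V,\ v\prec x\}$. For a vertex $x$, $N^+_D(x)=\{v\in V(D)\mid (x,v)\in A(D)\}$. The phylogeny graph $P(D)$ is the simple undirected graph with $V(P(D))=V(D)$ and $E(P(D))=\{xy\mid x\neq y,\ N^+_D(x)\cap N^+_D(y)\neq\emptyset\}\cup\{xy\mid (x,y)\in A(D)\}$. A graph $G$ is an interval graph if there is an assignment of real closed intervals $J(v)$ to the vertices $v$ such that for distinct $v,w$, $vw\in E(G)$ iff $J(v)\cap J(w)\neq\emptyset$.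
   Formalization: Interval endpoints are rational instead of real, for $G$ as well as for $\tilde{G}$, and the points of the doubly partial order $D$ have rational coordinates. -}

module Defs where

open import Data.Nat using (ℕ)
open import Data.Fin using (Fin)
open import Data.Rational using (ℚ; _<_; _≤_)
open import Data.Product using (Σ; ∃; _×_; _,_; proj₁; proj₂)
open import Data.Sum using (_⊎_)
open import Relation.Binary.PropositionalEquality using (_≡_; _≢_)
open import Relation.Nullary using (¬_)
open import Function.Bundles using (_⇔_)
open import Function.Definitions using (Injective)
open import Level using (0ℓ)

record Graph (n : ℕ) : Set₁ where
  field
    Adj     : Fin n → Fin n → Set
    sym     : ∀ {u v} → Adj u v → Adj v u
    irrefl  : ∀ v → ¬ Adj v v
open Graph public

Interval : Set
Interval = Σ (ℚ × ℚ) λ ab → proj₁ ab ≤ proj₂ ab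

_∈I_ : ℚ → Interval → Set
x ∈I ((a , b) , _) = (a ≤ x) × (x ≤ b)

Meets : Interval → Interval → Set
Meets I K = ∃ λ x → (x ∈I I) × (x ∈I K)

IsIntervalGraph : ∀ {n} → Graph n → Set
IsIntervalGraph {n} G =
  Σ (Fin n → Interval) λ J →
    ∀ v w → v ≢ w → (Adj G v w ⇔ Meets (J v) (J w))

IsInducedSubgraph : ∀ {n m} → Graph n → Graph m → Set
IsInducedSubgraph {n} {m} G H =
  Σ (Fin n → Fin m) λ f →
    Injective _≡_ _≡_ f × (∀ u v → Adj G u v ⇔ Adj H (f u) (f v))

Point : Set
Point = ℚ × ℚ

_≺_ : Point → Point → Set
x ≺ y = (proj₁ x < proj₁ y) × (proj₂ x < proj₂ y)

record DoublyPartialOrder (m : ℕ) : Set where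
  field
    pt     : Fin m → Point
    pt-inj : Injective _≡_ _≡_ pt
open DoublyPartialOrder public

Arc : ∀ {m} → DoublyPartialOrder m → Fin m → Fin m → Set
Arc D x v = pt D v ≺ pt D x

PhyAdj : ∀ {m} → DoublyPartialOrder m → Fin m → Fin m → Set
PhyAdj D x y =
  (x ≢ y) ×
  ((∃ λ v → Arc D x v × Arc D y v) ⊎ Arc D x y ⊎ Arc D y x)

IsPhylogenyGraphOf : ∀ {m} → Graph m → DoublyPartialOrder m → Set
IsPhylogenyGraphOf H D = ∀ x y → Adj H x y ⇔ PhyAdj D x y

module Submission where

-- Rank the endpoints of an interval model of G so that they become distinct
-- natural numbers, and add for every vertex v a new vertex whose interval is
-- the point left v.  Put a vertex with interval [l , h] at (h , - l), the new
-- vertex of v one unit lower, at (left v , - left v - 1).  Then u can only eat c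
-- when the interval of c lies inside that of u, so adjacent vertices of the
-- phylogeny graph have meeting intervals.  Conversely, an original vertex eats
-- every new vertex whose point lies in its interval, so two meeting original
-- intervals share the new vertex of the one starting later as a common prey.
-- Hence the phylogeny graph is the interval graph of the extended model, and G
-- is induced on the original vertices.

open import Defs
open import Data.Nat using (ℕ; suc; _+_; _≤_; _<_; z≤n; s≤s; s≤s⁻¹)
import Data.Nat.Properties as ℕ
open import Data.Nat.Coprimality using (1-coprimeTo) renaming (sym to coprime-sym)
open import Data.Integer as ℤ using (ℤ; +_; +<+; +≤+)
import Data.Integer.Properties as ℤ
open import Data.Rational as ℚ using (ℚ; mkℚ; *<*; *≤*)
import Data.Rational.Properties as ℚ
open import Data.Fin using (Fin; toℕ; _↑ˡ_; splitAt; join; _≟_)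
import Data.Fin.Properties as Fin
open import Data.List using (List; []; _∷_; map; _++_; allFin)
open import Data.List.Relation.Unary.Any using (here; there)
open import Data.List.Membership.Propositional using (_∈_)
open import Data.List.Membership.Propositional.Properties using (∈-map⁺; ∈-++⁺ˡ; ∈-++⁺ʳ; ∈-allFin)
open import Data.Product using (Σ; ∃; _×_; _,_; proj₁; proj₂)
open import Data.Product.Function.NonDependent.Propositional using (_×-⇔_)
open import Data.Product.Relation.Binary.Lex.Strict using (×-strictTotalOrder)
open import Data.Sum using (_⊎_; inj₁; inj₂)
open import Function using (_∘_)
open import Function.Bundles using (_⇔_; mk⇔; module Equivalence)
open import Function.Definitions using (Injective)
import Function.Properties.Equivalence as ⇔
open import Level using (0ℓ)
open import Relation.Binary.Bundles using (StrictTotalOrder)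
open import Relation.Binary.Definitions using (tri<; tri≈; tri>)
open import Relation.Binary.PropositionalEquality
  using (_≡_; _≢_; refl; cong; subst; subst₂) renaming (sym to ≡-sym; trans to ≡-trans)
open import Relation.Binary.Reasoning.Setoid (⇔.⇔-setoid 0ℓ)
open import Relation.Nullary using (yes; no; contradiction)

open Equivalence using (to; from)

module Rank {a ℓ₁ ℓ₂} (O : StrictTotalOrder a ℓ₁ ℓ₂) where
  open StrictTotalOrder O renaming (Carrier to A; _<_ to _⊏_; irrefl to ⊏-irrefl; trans to ⊏-trans)

  rank : A → List A → ℕ
  rank x [] = 0
  rank x (y ∷ ys) with y <? x
  ... | yes _ = suc (rank x ys)
  ... | no _  = rank x ys

  rank-mono-≤ : ∀ {x y} ys → x ⊏ y → rank x ys ≤ rank y ys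
  rank-mono-≤ [] _ = z≤n
  rank-mono-≤ {x} {y} (z ∷ zs) x⊏y with z <? x | z <? y
  ... | yes _   | yes _   = s≤s (rank-mono-≤ zs x⊏y)
  ... | yes z⊏x | no ¬z⊏y  = contradiction (⊏-trans z⊏x x⊏y) ¬z⊏y
  ... | no _    | yes _   = ℕ.m≤n⇒m≤1+n (rank-mono-≤ zs x⊏y)
  ... | no _    | no _    = rank-mono-≤ zs x⊏y

  rank-mono-< : ∀ {x y} ys → x ⊏ y → x ∈ ys → rank x ys < rank y ys
  rank-mono-< {x} {y} (z ∷ zs) x⊏y (here refl) with z <? x | z <? y
  ... | yes x⊏x | _      = contradiction x⊏x (⊏-irrefl Eq.refl)
  ... | no _    | yes _  = s≤s (rank-mono-≤ zs x⊏y)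
  ... | no _    | no ¬x⊏y = contradiction x⊏y ¬x⊏y
  rank-mono-< {x} {y} (z ∷ zs) x⊏y (there x∈zs) with z <? x | z <? y
  ... | yes _   | yes _   = s≤s (rank-mono-< zs x⊏y x∈zs)
  ... | yes z⊏x | no ¬z⊏y  = contradiction (⊏-trans z⊏x x⊏y) ¬z⊏y
  ... | no _    | yes _   = ℕ.m≤n⇒m≤1+n (rank-mono-< zs x⊏y x∈zs)
  ... | no _    | no _    = rank-mono-< zs x⊏y x∈zs

  rank-injective : ∀ {x y} ys → x ∈ ys → y ∈ ys → rank x ys ≡ rank y ys → x ≈ y
  rank-injective {x} {y} ys x∈ys y∈ys eq with compare x y
  ... | tri< x⊏y _ _ = contradiction eq (ℕ.<⇒≢ (rank-mono-< ys x⊏y x∈ys))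
  ... | tri≈ _ x≈y _ = x≈y
  ... | tri> _ _ y⊏x = contradiction (≡-sym eq) (ℕ.<⇒≢ (rank-mono-< ys y⊏x y∈ys))

fromℤ : ℤ → ℚ
fromℤ z = mkℚ z 0 (coprime-sym (1-coprimeTo _))

fromℤ-mono-< : ∀ {i j} → i ℤ.< j → fromℤ i ℚ.< fromℤ j
fromℤ-mono-< {i} {j} i<j =
  *<* (subst₂ ℤ._<_ (≡-sym (ℤ.*-identityʳ i)) (≡-sym (ℤ.*-identityʳ j)) i<j)

fromℤ-cancel-< : ∀ {i j} → fromℤ i ℚ.< fromℤ j → i ℤ.< j
fromℤ-cancel-< {i} {j} (*<* i<j) = subst₂ ℤ._<_ (ℤ.*-identityʳ i) (ℤ.*-identityʳ j) i<j

fromℤ-mono-≤ : ∀ {i j} → i ℤ.≤ j → fromℤ i ℚ.≤ fromℤ j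
fromℤ-mono-≤ {i} {j} i≤j =
  *≤* (subst₂ ℤ._≤_ (≡-sym (ℤ.*-identityʳ i)) (≡-sym (ℤ.*-identityʳ j)) i≤j)

fromℤ-cancel-≤ : ∀ {i j} → fromℤ i ℚ.≤ fromℤ j → i ℤ.≤ j
fromℤ-cancel-≤ {i} {j} (*≤* i≤j) = subst₂ ℤ._≤_ (ℤ.*-identityʳ i) (ℤ.*-identityʳ j) i≤j

fromℤ-injective : Injective _≡_ _≡_ fromℤ
fromℤ-injective = cong ℚ.ℚ.numerator

lower upper : Interval → ℚ
lower I = proj₁ (proj₁ I)
upper I = proj₂ (proj₁ I)

meets⇔endpoints : ∀ I K → Meets I K ⇔ (lower I ℚ.≤ upper K × lower K ℚ.≤ upper I)
meets⇔endpoints I K = mk⇔ endpoints common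
  where
  endpoints : Meets I K → lower I ℚ.≤ upper K × lower K ℚ.≤ upper I
  endpoints (x , (I≤x , x≤I) , (K≤x , x≤K)) = ℚ.≤-trans I≤x x≤K , ℚ.≤-trans K≤x x≤I
  common : lower I ℚ.≤ upper K × lower K ℚ.≤ upper I → Meets I K
  common (I≤K , K≤I) with ℚ.≤-total (lower I) (lower K)
  ... | inj₁ I≤K′ = lower K , (I≤K′ , K≤I) , (ℚ.≤-refl , proj₂ K)
  ... | inj₂ K≤I′ = lower I , (ℚ.≤-refl , proj₂ I) , (K≤I′ , I≤K)

IsIntervalModel : ∀ {n} → Graph n → (Fin n → Interval) → Set
IsIntervalModel G J = ∀ v w → v ≢ w → (Adj G v w ⇔ Meets (J v) (J w))

inducedSubgraph-viaIntervalModels :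
  ∀ {n m} {G : Graph n} {H : Graph m} {J : Fin n → Interval} {K : Fin m → Interval} →
  IsIntervalModel G J → IsIntervalModel H K →
  (f : Fin n → Fin m) → Injective _≡_ _≡_ f →
  (∀ u v → Meets (J u) (J v) ⇔ Meets (K (f u)) (K (f v))) →
  IsInducedSubgraph G H
inducedSubgraph-viaIntervalModels {G = G} {H} {J} {K} G-model H-model f f-inj meets-f =
  f , f-inj , adjacent⇔
  where
  adjacent⇔ : ∀ u v → Adj G u v ⇔ Adj H (f u) (f v)
  adjacent⇔ u v with u ≟ v
  ... | yes refl =
    mk⇔ (λ uu → contradiction uu (irrefl G u)) (λ uu → contradiction uu (irrefl H (f u)))
  ... | no u≢v = begin
    Adj G u v                ≈⟨ G-model u v u≢v ⟩
    Meets (J u) (J v)        ≈⟨ meets-f u v ⟩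
    Meets (K (f u)) (K (f v)) ≈⟨ ⇔.sym (H-model (f u) (f v) (u≢v ∘ f-inj)) ⟩
    Adj H (f u) (f v)        ∎

phylogenyGraph : ∀ {m} → DoublyPartialOrder m → Graph m
phylogenyGraph D = record { Adj = PhyAdj D ; sym = phy-sym ; irrefl = λ v vv → proj₁ vv refl }
  where
  phy-sym : ∀ {x y} → PhyAdj D x y → PhyAdj D y x
  phy-sym (x≢y , inj₁ (v , xv , yv))  = x≢y ∘ ≡-sym , inj₁ (v , yv , xv)
  phy-sym (x≢y , inj₂ (inj₁ xy))      = x≢y ∘ ≡-sym , inj₂ (inj₂ xy)
  phy-sym (x≢y , inj₂ (inj₂ yx))      = x≢y ∘ ≡-sym , inj₂ (inj₁ yx)

record DistinctEndpointModel (n : ℕ) : Set where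
  field
    left right     : Fin n → ℕ
    left<right     : ∀ v → left v < right v
    left-injective : Injective _≡_ _≡_ left
    left≢right     : ∀ v w → left v ≢ right w

  Overlap : Fin n → Fin n → Set
  Overlap v w = left v ≤ right w × left w ≤ right v

open DistinctEndpointModel

-- Endpoints are ranked by (value , index), every left index being below every
-- right one: a left endpoint thus precedes a right endpoint of equal value, so
-- ranking does not change which intervals meet.
distinctEndpointModel : ∀ {n} (J : Fin n → Interval) →
  Σ (DistinctEndpointModel n) λ M → ∀ v w → Meets (J v) (J w) ⇔ Overlap M v w
distinctEndpointModel {n} J =
  M , λ v w → ⇔.trans (meets⇔endpoints (J v) (J w)) (left≤right⇔ v w ×-⇔ left≤right⇔ w v)
  where
  Key : StrictTotalOrder 0ℓ 0ℓ 0ℓ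
  Key = ×-strictTotalOrder ℚ.<-strictTotalOrder ℕ.<-strictTotalOrder
  open StrictTotalOrder Key using () renaming (_<_ to _⊏_)
  open Rank Key

  leftKey rightKey : Fin n → ℚ × ℕ
  leftKey v = lower (J v) , toℕ v
  rightKey v = upper (J v) , n + toℕ v

  keys : List (ℚ × ℕ)
  keys = map leftKey (allFin n) ++ map rightKey (allFin n)

  leftKey∈keys : ∀ v → leftKey v ∈ keys
  leftKey∈keys v = ∈-++⁺ˡ (∈-map⁺ leftKey (∈-allFin v))

  rightKey∈keys : ∀ v → rightKey v ∈ keys
  rightKey∈keys v = ∈-++⁺ʳ _ (∈-map⁺ rightKey (∈-allFin v))

  left′ right′ : Fin n → ℕ
  left′ v = rank (leftKey v) keys
  right′ v = rank (rightKey v) keys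

  index<n+index : ∀ v w → toℕ v < n + toℕ w
  index<n+index v w = ℕ.<-≤-trans (Fin.toℕ<n v) (ℕ.m≤m+n n (toℕ w))

  leftKey<rightKey : ∀ {v w} → lower (J v) ℚ.≤ upper (J w) → leftKey v ⊏ rightKey w
  leftKey<rightKey {v} {w} v≤w with ℚ.<-cmp (lower (J v)) (upper (J w))
  ... | tri< v<w _ _ = inj₁ v<w
  ... | tri≈ _ v≡w _ = inj₂ (v≡w , index<n+index v w)
  ... | tri> _ _ w<v = contradiction (ℚ.<-≤-trans w<v v≤w) (ℚ.<-irrefl refl)

  left′<right′ : ∀ {v w} → lower (J v) ℚ.≤ upper (J w) → left′ v < right′ w
  left′<right′ v≤w = rank-mono-< keys (leftKey<rightKey v≤w) (leftKey∈keys _)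

  left′≢right′ : ∀ v w → left′ v ≢ right′ w
  left′≢right′ v w eq =
    ℕ.<⇒≢ (index<n+index v w) (proj₂ (rank-injective keys (leftKey∈keys v) (rightKey∈keys w) eq))

  M : DistinctEndpointModel n
  M = record
    { left           = left′
    ; right          = right′
    ; left<right     = λ v → left′<right′ (proj₂ (J v))
    ; left-injective = λ {v} {w} eq →
        Fin.toℕ-injective (proj₂ (rank-injective keys (leftKey∈keys v) (leftKey∈keys w) eq))
    ; left≢right     = left′≢right′
    }

  left≤right⇔ : ∀ v w → lower (J v) ℚ.≤ upper (J w) ⇔ left′ v ≤ right′ w
  left≤right⇔ v w = mk⇔ (ℕ.<⇒≤ ∘ left′<right′) fromRanks
    where
    fromRanks : left′ v ≤ right′ w → lower (J v) ℚ.≤ upper (J w)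
    fromRanks v≤w with lower (J v) ℚ.≤? upper (J w)
    ... | yes v≤w′ = v≤w′
    ... | no v≰w =
      contradiction v≤w (ℕ.<⇒≱ (rank-mono-< keys (inj₁ (ℚ.≰⇒> v≰w)) (rightKey∈keys w)))

-- inj₁ v is the vertex v itself and inj₂ v a new vertex whose interval is the
-- single point left v.
module Extension {n} (M : DistinctEndpointModel n) where

  Vertex : Set
  Vertex = Fin n ⊎ Fin n

  low high ordinate : Vertex → ℕ
  low (inj₁ v) = left M v
  low (inj₂ v) = left M v
  high (inj₁ v) = right M v
  high (inj₂ v) = left M v
  ordinate (inj₁ v) = left M v
  ordinate (inj₂ v) = suc (left M v)

  low≤high : ∀ u → low u ≤ high u
  low≤high (inj₁ v) = ℕ.<⇒≤ (left<right M v)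
  low≤high (inj₂ v) = ℕ.≤-refl

  Eats : Vertex → Vertex → Set
  Eats u c = high c < high u × ordinate u < ordinate c

  Related : Vertex → Vertex → Set
  Related u w = (∃ λ c → Eats u c × Eats w c) ⊎ Eats u w ⊎ Eats w u

  Meet : Vertex → Vertex → Set
  Meet u w = low u ≤ high w × low w ≤ high u

  Contains : Vertex → Vertex → Set
  Contains u c = low u ≤ low c × high c ≤ high u

  contains-refl : ∀ u → Contains u u
  contains-refl u = ℕ.≤-refl , ℕ.≤-refl

  meet-viaCommon : ∀ u w c → Contains u c → Contains w c → Meet u w
  meet-viaCommon u w c (uc , cu) (wc , cw) =
    ℕ.≤-trans uc (ℕ.≤-trans (low≤high c) cw) , ℕ.≤-trans wc (ℕ.≤-trans (low≤high c) cu)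

  eats⇒contains : ∀ u c → Eats u c → Contains u c
  eats⇒contains u c (c<u , u<c) =
    s≤s⁻¹ (ℕ.<-≤-trans (ℕ.≤-<-trans (low≤ordinate u) u<c) (ordinate≤1+low c)) , ℕ.<⇒≤ c<u
    where
    low≤ordinate : ∀ u → low u ≤ ordinate u
    low≤ordinate (inj₁ v) = ℕ.≤-refl
    low≤ordinate (inj₂ v) = ℕ.n≤1+n _
    ordinate≤1+low : ∀ u → ordinate u ≤ suc (low u)
    ordinate≤1+low (inj₁ v) = ℕ.n≤1+n _
    ordinate≤1+low (inj₂ v) = ℕ.≤-refl

  related⇒meet : ∀ u w → Related u w → Meet u w
  related⇒meet u w (inj₁ (c , uc , wc)) =
    meet-viaCommon u w c (eats⇒contains u c uc) (eats⇒contains w c wc)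
  related⇒meet u w (inj₂ (inj₁ uw)) = meet-viaCommon u w w (eats⇒contains u w uw) (contains-refl w)
  related⇒meet u w (inj₂ (inj₂ wu)) = meet-viaCommon u w u (contains-refl u) (eats⇒contains w u wu)

  eats-point : ∀ {v w} → left M v ≤ left M w → left M w ≤ right M v → Eats (inj₁ v) (inj₂ w)
  eats-point {v} {w} v≤w w≤v = ℕ.≤∧≢⇒< w≤v (left≢right M w v) , s≤s v≤w

  meet⇒related : ∀ {u w} → u ≢ w → Meet u w → Related u w
  meet⇒related {inj₁ v} {inj₁ w} _ (v≤w , w≤v) with ℕ.≤-total (left M v) (left M w)
  ... | inj₁ v≤w′ = inj₁ (inj₂ w , eats-point v≤w′ w≤v , eats-point ℕ.≤-refl (low≤high (inj₁ w)))
  ... | inj₂ w≤v′ = inj₁ (inj₂ v , eats-point ℕ.≤-refl (low≤high (inj₁ v)) , eats-point w≤v′ v≤w)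
  meet⇒related {inj₁ v} {inj₂ w} _ (v≤w , w≤v) = inj₂ (inj₁ (eats-point v≤w w≤v))
  meet⇒related {inj₂ v} {inj₁ w} _ (v≤w , w≤v) = inj₂ (inj₂ (eats-point w≤v v≤w))
  meet⇒related {inj₂ v} {inj₂ w} v≢w (v≤w , w≤v) =
    contradiction (cong inj₂ (left-injective M (ℕ.≤-antisym v≤w w≤v))) v≢w

  related⇔meet : ∀ {u w} → u ≢ w → Related u w ⇔ Meet u w
  related⇔meet {u} {w} u≢w = mk⇔ (related⇒meet u w) (meet⇒related u≢w)

  point : Vertex → Point
  point u = fromℤ (+ high u) , fromℤ (ℤ.- + ordinate u)

  ≺⇔eats : ∀ u c → point c ≺ point u ⇔ Eats u c
  ≺⇔eats u c = mk⇔
    (λ (x< , y<) →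
       ℤ.drop‿+<+ (fromℤ-cancel-< x<) , ℤ.drop‿+<+ (ℤ.neg-cancel-< (fromℤ-cancel-< y<)))
    (λ (x< , y<) → fromℤ-mono-< (+<+ x<) , fromℤ-mono-< (ℤ.neg-mono-< (+<+ y<)))

  point-injective : Injective _≡_ _≡_ point
  point-injective {u} {w} eq = coordinates u w
    (ℤ.+-injective (fromℤ-injective (cong proj₁ eq)))
    (ℤ.+-injective (ℤ.neg-injective (fromℤ-injective (cong proj₂ eq))))
    where
    coordinates : ∀ u w → high u ≡ high w → ordinate u ≡ ordinate w → u ≡ w
    coordinates (inj₁ v) (inj₁ w) _ eq = cong inj₁ (left-injective M eq)
    coordinates (inj₁ v) (inj₂ w) eq _ = contradiction (≡-sym eq) (left≢right M w v)
    coordinates (inj₂ v) (inj₁ w) eq _ = contradiction eq (left≢right M v w)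
    coordinates (inj₂ v) (inj₂ w) _ eq = cong inj₂ (left-injective M (ℕ.suc-injective eq))

  vertex : Fin (n + n) → Vertex
  vertex = splitAt n

  vertex-injective : Injective _≡_ _≡_ vertex
  vertex-injective {i} {j} eq =
    ≡-trans (≡-sym (Fin.join-splitAt n n i)) (≡-trans (cong (join n n) eq) (Fin.join-splitAt n n j))

  D : DoublyPartialOrder (n + n)
  D = record { pt = point ∘ vertex ; pt-inj = vertex-injective ∘ point-injective }

  phyAdj⇔related : ∀ i j → PhyAdj D i j ⇔ (i ≢ j × Related (vertex i) (vertex j))
  phyAdj⇔related i j = ⇔.refl ×-⇔ mk⇔ toRelated fromRelated
    where
    arc⇔ : ∀ x y → Arc D x y ⇔ Eats (vertex x) (vertex y)
    arc⇔ x y = ≺⇔eats (vertex x) (vertex y)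
    Arcs : Set
    Arcs = (∃ λ c → Arc D i c × Arc D j c) ⊎ Arc D i j ⊎ Arc D j i
    toRelated : Arcs → Related (vertex i) (vertex j)
    toRelated (inj₁ (c , ic , jc)) = inj₁ (vertex c , to (arc⇔ i c) ic , to (arc⇔ j c) jc)
    toRelated (inj₂ (inj₁ ij))     = inj₂ (inj₁ (to (arc⇔ i j) ij))
    toRelated (inj₂ (inj₂ ji))     = inj₂ (inj₂ (to (arc⇔ j i) ji))
    fromRelated : Related (vertex i) (vertex j) → Arcs
    fromRelated (inj₁ (c , ic , jc)) =
      inj₁ (join n n c ,
            from (arc⇔ i _) (eatsPrey (vertex i) ic) , from (arc⇔ j _) (eatsPrey (vertex j) jc))
      where
      eatsPrey : ∀ u → Eats u c → Eats u (vertex (join n n c))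
      eatsPrey u = subst (Eats u) (≡-sym (Fin.splitAt-join n n c))
    fromRelated (inj₂ (inj₁ ij))     = inj₂ (inj₁ (from (arc⇔ i j) ij))
    fromRelated (inj₂ (inj₂ ji))     = inj₂ (inj₂ (from (arc⇔ j i) ji))

  interval : Vertex → Interval
  interval u = (fromℤ (+ low u) , fromℤ (+ high u)) , fromℤ-mono-≤ (+≤+ (low≤high u))

  meets⇔meet : ∀ u w → Meets (interval u) (interval w) ⇔ Meet u w
  meets⇔meet u w = ⇔.trans (meets⇔endpoints (interval u) (interval w)) (fromℕ-≤⇔ ×-⇔ fromℕ-≤⇔)
    where
    fromℕ-≤⇔ : ∀ {k l} → fromℤ (+ k) ℚ.≤ fromℤ (+ l) ⇔ k ≤ l
    fromℕ-≤⇔ = mk⇔ (ℤ.drop‿+≤+ ∘ fromℤ-cancel-≤) (fromℤ-mono-≤ ∘ +≤+)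

  extendedModel : Fin (n + n) → Interval
  extendedModel = interval ∘ vertex

  extendedModel-isIntervalModel : IsIntervalModel (phylogenyGraph D) extendedModel
  extendedModel-isIntervalModel i j i≢j = begin
    PhyAdj D i j                              ≈⟨ phyAdj⇔related i j ⟩
    (i ≢ j × Related (vertex i) (vertex j))   ≈⟨ mk⇔ proj₂ (i≢j ,_) ⟩
    Related (vertex i) (vertex j)             ≈⟨ related⇔meet (i≢j ∘ vertex-injective) ⟩
    Meet (vertex i) (vertex j)                ≈⟨ ⇔.sym (meets⇔meet (vertex i) (vertex j)) ⟩
    Meets (extendedModel i) (extendedModel j) ∎

  overlap⇔meets-extendedModel : ∀ u v →
    Overlap M u v ⇔ Meets (extendedModel (u ↑ˡ n)) (extendedModel (v ↑ˡ n))
  overlap⇔meets-extendedModel u v rewrite Fin.splitAt-↑ˡ n u n | Fin.splitAt-↑ˡ n v n =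
    ⇔.sym (meets⇔meet (inj₁ u) (inj₁ v))

theorem2p3 : ∀ (n : ℕ) (G : Graph n) → IsIntervalGraph G →
    Σ ℕ λ m → Σ (Graph m) λ G̃ →
      IsIntervalGraph G̃ × IsInducedSubgraph G G̃ ×
      Σ (DoublyPartialOrder m) λ D → IsPhylogenyGraphOf G̃ D
theorem2p3 n G (J , J-isModel) with distinctEndpointModel J
... | M , meets⇔overlap =
  n + n , phylogenyGraph D ,
  (extendedModel , extendedModel-isIntervalModel) ,
  inducedSubgraph-viaIntervalModels {G = G} {phylogenyGraph D} {J} {extendedModel}
    J-isModel extendedModel-isIntervalModel (_↑ˡ n) (Fin.↑ˡ-injective n _ _)
    (λ u v → ⇔.trans (meets⇔overlap u v) (overlap⇔meets-extendedModel u v)) ,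
  D , λ _ _ → ⇔.refl
  where open Extension M
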